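{- Let $G$ be a connected graph and consider the game with $k\geq 2$ cops on $G$, at a state where the cops are at positions $c_1,\dots,c_k$, the robber is at $r$, and it is the cops' turn to move. If every vertex of the robber's safe neighborhood $S(R)$ has degree at most $3$ in $G$, and at most one vertex of $S(R)$ has degree exactly $3$ in $G$, then the cops have a winning strategy from this state.
   Context: Cops and Robbers: players occupy vertices; on their turn each cop moves to an adjacent vertex or stays (several cops may share a vertex), and on his turn the robber moves to an adjacent vertex or stays; the cops win if a cop occupies the robber's vertex. For $v\in V(G)$, $N[v]=N(v)\cup\{v\}$ is its closed neighborhood, and for $S\subseteq V$, $N[S]=\bigcup_{v\in S}N[v]$. With $C=\{c_1,\dots,c_k\}$ the set of cop positions, the robber's safe neighborhood $S(R)$ is the connected component of $G-N[C]$ containing the robber (empty if $r\in N[C]$). -}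

module Defs where

open import Data.Nat using (ℕ)
open import Data.Fin using (Fin)
open import Data.List using (List; length; filter; allFin)
open import Data.Product using (Σ; ∃; _×_; _,_)
open import Data.Sum using (_⊎_)
open import Data.Unit using (⊤)
open import Relation.Nullary using (¬_)
open import Relation.Unary using (Pred)
open import Relation.Binary using (Rel; Decidable; Symmetric; Irreflexive)
open import Relation.Binary.PropositionalEquality using (_≡_)

record Graph : Set₁ where
  field
    n     : ℕ
    Adj   : Rel (Fin n) _
    adj?  : Decidable Adj
    sym   : Symmetric Adj
    irrefl : Irreflexive _≡_ Adj

module _ (G : Graph) where
  open Graph G

  V : Set
  V = Fin n

  deg : V → ℕ
  deg v = length (filter (adj? v) (allFin n))

  InClosedNbhd : V → V → Set
  InClosedNbhd v u = u ≡ v ⊎ Adj v u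

  data Walk (P : Pred V _) : V → V → Set where
    nil  : ∀ {u} → P u → Walk P u u
    cons : ∀ {u w v} → P u → Adj u w → Walk P w v → Walk P u v

  Connected : Set
  Connected = ∀ u v → Walk (λ _ → ⊤) u v

  module _ {k : ℕ} where

    InNC : (Fin k → V) → V → Set
    InNC C u = ∃ λ i → InClosedNbhd (C i) u

    -- v ∈ S(R): v lies in the connected component of G - N[C] containing r
    -- (empty if r ∈ N[C], since a walk's vertices all avoid N[C])
    InSafe : (Fin k → V) → V → V → Set
    InSafe C r v = Walk (λ u → ¬ InNC C u) r v

    CopMove : (Fin k → V) → (Fin k → V) → Set
    CopMove C C′ = ∀ i → InClosedNbhd (C i) (C′ i)

    Captured : (Fin k → V) → V → Set
    Captured C r = ∃ λ i → C i ≡ r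

    -- CopsWin C r : cops at C, robber at r, cops to move, and the cops have a
    -- strategy that captures the robber after finitely many moves against
    -- every robber play.
    data CopsWin : (Fin k → V) → V → Set where
      win : ∀ {C r} (C′ : Fin k → V) → CopMove C C′ →
            (Captured C′ r ⊎
             (∀ r′ → InClosedNbhd r r′ → Captured C′ r′ ⊎ CopsWin C′ r′)) →
            CopsWin C r

-- The cops first confine the robber to a connected region L that is free of their closed
-- neighbourhoods and whose outer boundary they cover.  If every vertex of L has degree at most 3
-- and at most one has degree 3, the degree sum of L is at most 2|L| + 1, while a spanning tree of
-- L already uses 2|L| - 2 of it, so at most three edges and hence at most three vertices leave L.
-- Three boundary vertices can be covered so that either a single cop covers all of them, or some
-- cop can step onto a boundary vertex without uncovering any other one.  In the second case that
-- cop now covers a vertex of L, so the robber's region shrinks.  In the first case that cop keeps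
-- L sealed while a second cop walks towards L, and the region shrinks as soon as it is reached.
module Submission where

open import Level using (0ℓ)
open import Function using (_∘_; const)
open import Data.Unit using (⊤)
open import Data.Product using (Σ; ∃; ∃₂; _×_; _,_; proj₁; proj₂)
import Data.Product as Product
open import Data.Sum using (_⊎_; inj₁; inj₂)
import Data.Sum as Sum
open import Data.Nat using (ℕ; suc; _+_; _≤_; _<_; _≥_; z≤n; s≤s)
open import Data.Nat.Properties
open import Data.Nat.Induction using (<-wellFounded)
open import Data.Nat.ListAction using (sum)
open import Data.Nat.Tactic.RingSolver using (solve-∀)
open import Data.Fin using (Fin; zero; suc) renaming (_≟_ to _≟ᶠ_)
import Data.Fin.Properties as Fin
open import Data.Vec.Functional using (updateAt)
open import Data.Vec.Functional.Properties using (updateAt-updates; updateAt-minimal)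
open import Data.List using (List; []; _∷_; length; filter; map; allFin)
open import Data.List.Properties using (map-cong; filter-some)
open import Data.List.Membership.Propositional using (_∈_; _∉_; lose; find)
open import Data.List.Membership.Propositional.Properties using (∈-allFin; ∈-filter⁺; ∈-filter⁻)
open import Data.List.Relation.Unary.Any using (Any; here; there)
import Data.List.Relation.Unary.Any as Any
import Data.List.Relation.Unary.All as All
open import Data.List.Relation.Unary.All.Properties using (¬Any⇒All¬)
open import Data.List.Relation.Unary.AllPairs using ([]; _∷_)
open import Data.List.Relation.Unary.Unique.Propositional using (Unique)
open import Induction.WellFounded using (Acc; acc)
open import Relation.Nullary using (¬_; Dec; yes; no; contradiction)
open import Relation.Nullary.Decidable using (_×-dec_; _⊎-dec_; ¬?)
open import Relation.Unary using (Pred; Decidable; _⊆_)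
open import Relation.Unary.Properties using (∁?; _∪?_; _∩?_)
open import Relation.Binary using (REL)
open import Relation.Binary.PropositionalEquality using (_≡_; _≢_; refl; sym; trans; cong; subst; module ≡-Reasoning)

open import Defs

module _ {a p q} {A : Set a} {P : Pred A p} {Q : Pred A q} (P? : Decidable P) (Q? : Decidable Q) where

  length-filter-mono : P ⊆ Q → ∀ xs → length (filter P? xs) ≤ length (filter Q? xs)
  length-filter-mono P⊆Q [] = z≤n
  length-filter-mono P⊆Q (x ∷ xs) with P? x | Q? x
  ... | yes _  | yes _  = s≤s (length-filter-mono P⊆Q xs)
  ... | yes px | no ¬qx = contradiction (P⊆Q px) ¬qx
  ... | no _   | yes _  = m≤n⇒m≤1+n (length-filter-mono P⊆Q xs)
  ... | no _   | no _   = length-filter-mono P⊆Q xs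

  length-filter-mono-< : P ⊆ Q → ∀ {y xs} → y ∈ xs → Q y → ¬ P y →
                         length (filter P? xs) < length (filter Q? xs)
  length-filter-mono-< P⊆Q {xs = x ∷ xs} (there y∈xs) qy ¬py with P? x | Q? x
  ... | yes _  | yes _  = s≤s (length-filter-mono-< P⊆Q y∈xs qy ¬py)
  ... | yes px | no ¬qx = contradiction (P⊆Q px) ¬qx
  ... | no _   | yes _  = m≤n⇒m≤1+n (length-filter-mono-< P⊆Q y∈xs qy ¬py)
  ... | no _   | no _   = length-filter-mono-< P⊆Q y∈xs qy ¬py
  length-filter-mono-< P⊆Q {xs = x ∷ xs} (here refl) qy ¬py with P? x | Q? x
  ... | yes px | _      = contradiction px ¬py
  ... | no _   | yes _  = s≤s (length-filter-mono P⊆Q xs)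
  ... | no _   | no ¬qx = contradiction qy ¬qx

  length-filter-∪ : ∀ xs → length (filter (P? ∪? Q?) xs) ≤ length (filter P? xs) + length (filter Q? xs)
  length-filter-∪ [] = z≤n
  length-filter-∪ (x ∷ xs) with P? x | Q? x | length-filter-∪ xs
  ... | yes _ | yes _ | ih = s≤s (≤-trans ih (+-monoʳ-≤ _ (n≤1+n _)))
  ... | yes _ | no _  | ih = s≤s ih
  ... | no _  | yes _ | ih = ≤-trans (s≤s ih) (≤-reflexive (sym (+-suc _ _)))
  ... | no _  | no _  | ih = ih

  length-filter-split : ∀ xs → length (filter P? xs) ≡
                        length (filter (P? ∩? Q?) xs) + length (filter (P? ∩? ∁? Q?) xs)
  length-filter-split [] = refl
  length-filter-split (x ∷ xs) with P? x | Q? x | length-filter-split xs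
  ... | yes _ | yes _ | ih = cong suc ih
  ... | yes _ | no _  | ih = trans (cong suc ih) (sym (+-suc _ _))
  ... | no _  | _     | ih = ih

module _ {a b r} {A : Set a} {B : Set b} {R : REL A B r} (R? : ∀ x y → Dec (R x y)) where

  length-filter-any≤sum : ∀ xs ys →
    length (filter (λ y → Any.any? (λ x → R? x y) xs) ys) ≤ sum (map (λ x → length (filter (R? x) ys)) xs)
  length-filter-any≤sum [] ys = ≤-reflexive (none ys)
    where
    none : ∀ ys → length (filter (λ y → Any.any? (λ x → R? x y) []) ys) ≡ 0
    none []       = refl
    none (_ ∷ ys) = none ys
  length-filter-any≤sum (x ∷ xs) ys = begin
    length (filter (λ y → Any.any? (λ x′ → R? x′ y) (x ∷ xs)) ys)
      ≤⟨ length-filter-mono _ (R? x ∪? (λ y → Any.any? (λ x′ → R? x′ y) xs)) split ys ⟩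
    length (filter (R? x ∪? (λ y → Any.any? (λ x′ → R? x′ y) xs)) ys)
      ≤⟨ length-filter-∪ (R? x) _ ys ⟩
    length (filter (R? x) ys) + length (filter (λ y → Any.any? (λ x′ → R? x′ y) xs) ys)
      ≤⟨ +-monoʳ-≤ _ (length-filter-any≤sum xs ys) ⟩
    sum (map (λ x′ → length (filter (R? x′) ys)) (x ∷ xs)) ∎
    where
    open ≤-Reasoning
    split : ∀ {y} → Any (λ x′ → R x′ y) (x ∷ xs) → R x y ⊎ Any (λ x′ → R x′ y) xs
    split (here rxy) = inj₁ rxy
    split (there any) = inj₂ any

module _ {a} {A : Set a} where

  sum-map-mono-≤ : ∀ {f g : A → ℕ} xs → (∀ {x} → x ∈ xs → f x ≤ g x) → sum (map f xs) ≤ sum (map g xs)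
  sum-map-mono-≤ []       f≤g = z≤n
  sum-map-mono-≤ (x ∷ xs) f≤g = +-mono-≤ (f≤g (here refl)) (sum-map-mono-≤ xs (f≤g ∘ there))

  sum-map-mono-< : ∀ {f g : A → ℕ} {y} xs → (∀ {x} → x ∈ xs → f x ≤ g x) → y ∈ xs → f y < g y →
                   sum (map f xs) < sum (map g xs)
  sum-map-mono-< (x ∷ xs) f≤g (here refl) fy<gy = +-mono-<-≤ fy<gy (sum-map-mono-≤ xs (f≤g ∘ there))
  sum-map-mono-< (x ∷ xs) f≤g (there y∈) fy<gy =
    +-mono-≤-< (f≤g (here refl)) (sum-map-mono-< xs (f≤g ∘ there) y∈ fy<gy)

  sum-map-+ : ∀ (f g : A → ℕ) xs → sum (map (λ x → f x + g x) xs) ≡ sum (map f xs) + sum (map g xs)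
  sum-map-+ f g []       = refl
  sum-map-+ f g (x ∷ xs) = begin
    f x + g x + sum (map (λ x → f x + g x) xs) ≡⟨ cong (f x + g x +_) (sum-map-+ f g xs) ⟩
    f x + g x + (F + Gs)                       ≡⟨ interchange (f x) (g x) F Gs ⟩
    f x + F + (g x + Gs)                       ∎
    where
    open ≡-Reasoning
    F  = sum (map f xs)
    Gs = sum (map g xs)
    interchange : ∀ a b c d → a + b + (c + d) ≡ a + c + (b + d)
    interchange = solve-∀

  sum-map≤twice-length : ∀ (f : A → ℕ) xs → (∀ {x} → x ∈ xs → f x ≤ 2) → sum (map f xs) ≤ length xs + length xs
  sum-map≤twice-length f []       _   = z≤n
  sum-map≤twice-length f (x ∷ xs) f≤2 =
    ≤-trans (+-mono-≤ (f≤2 (here refl)) (sum-map≤twice-length f xs (f≤2 ∘ there)))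
            (≤-reflexive (cong suc (sym (+-suc (length xs) (length xs)))))

  sum-map≤twice-length+1 : ∀ (f : A → ℕ) {xs} → Unique xs → (∀ {x} → x ∈ xs → f x ≤ 3) →
    (∀ {x y} → x ∈ xs → y ∈ xs → f x ≡ 3 → f y ≡ 3 → x ≡ y) →
    sum (map f xs) ≤ length xs + length xs + 1
  sum-map≤twice-length+1 f {[]} _ _ _ = z≤n
  sum-map≤twice-length+1 f {x ∷ xs} (x∉xs ∷ unique) f≤3 one3 with f x ≟ 3
  ... | yes fx≡3 = ≤-trans (+-mono-≤ (≤-reflexive fx≡3) (sum-map≤twice-length f xs others≤2))
                           (≤-reflexive (arith (length xs)))
    where
    others≤2 : ∀ {y} → y ∈ xs → f y ≤ 2
    others≤2 y∈ = ≤-pred (≤∧≢⇒< (f≤3 (there y∈))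
                    (λ fy≡3 → All.lookup x∉xs y∈ (one3 (here refl) (there y∈) fx≡3 fy≡3)))
    arith : ∀ l → 3 + (l + l) ≡ suc l + suc l + 1
    arith = solve-∀
  ... | no fx≢3 = ≤-trans (+-mono-≤ (≤-pred (≤∧≢⇒< (f≤3 (here refl)) fx≢3)) rest)
                          (≤-reflexive (arith (length xs)))
    where
    rest = sum-map≤twice-length+1 f unique (f≤3 ∘ there) λ x∈ y∈ → one3 (there x∈) (there y∈)
    arith : ∀ l → 2 + (l + l + 1) ≡ suc l + suc l + 1
    arith = solve-∀

module _ {a i ℓ} {A : Set a} {I : Set i} (Cov : I → A → Set ℓ) where

  Guards : I → List A → Set _
  Guards i ys = ∀ {y} → y ∈ ys → Cov i y

  -- If i moves onto y, every point of ys that i covered stays covered.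
  Releases : I → A → List A → Set _
  Releases i y ys = y ∈ ys × Cov i y × (∀ {z} → z ∈ ys → Cov i z → z ≡ y ⊎ ∃ λ j → j ≢ i × Cov j z)

  releases-sole : ∀ {i y ys} → y ∈ ys → Cov i y → (∀ {z} → z ∈ ys → Cov i z → z ≡ y) → Releases i y ys
  releases-sole y∈ iy sole = y∈ , iy , λ z∈ iz → inj₁ (sole z∈ iz)

  releases-other : ∀ {i j y ys} → y ∈ ys → ¬ Cov i y → Cov j y → (∀ {z} → z ∈ ys → z ≡ y ⊎ Cov i z) →
                   Releases j y ys
  releases-other {i} y∈ ¬iy jy rest = y∈ , jy , λ z∈ _ → Sum.map₂ (λ iz → i , i≢j , iz) (rest z∈)
    where
    i≢j : i ≢ _
    i≢j refl = ¬iy jy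

  guards-or-releases : (∀ i x → Dec (Cov i x)) → I → ∀ ys → length ys ≤ 3 →
                       (∀ {y} → y ∈ ys → ∃ λ i → Cov i y) →
                       (∃ λ i → Guards i ys) ⊎ (∃₂ λ i y → Releases i y ys)
  guards-or-releases _ i₀ [] _ _ = inj₁ (i₀ , λ ())
  guards-or-releases Cov? _ (y₁ ∷ []) _ cover with cover (here refl)
  ... | i , c₁ = inj₁ (i , λ { (here refl) → c₁ })
  guards-or-releases Cov? _ (y₁ ∷ y₂ ∷ []) _ cover with cover (here refl)
  ... | i , c₁ with Cov? i y₂
  ... | yes c₂ = inj₁ (i , λ { (here refl) → c₁ ; (there (here refl)) → c₂ })
  ... | no ¬c₂ = inj₂ (i , y₁ , releases-sole (here refl) c₁ λ
          { (here refl)         _  → refl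
          ; (there (here refl)) c₂ → contradiction c₂ ¬c₂
          })
  guards-or-releases Cov? _ (y₁ ∷ y₂ ∷ y₃ ∷ []) _ cover with cover (here refl)
  ... | i , c₁ with Cov? i y₂ | Cov? i y₃
  ... | yes c₂ | yes c₃ = inj₁ (i , λ
          { (here refl)                 → c₁
          ; (there (here refl))         → c₂
          ; (there (there (here refl))) → c₃
          ; (there (there (there ())))
          })
  ... | no ¬c₂ | no ¬c₃ = inj₂ (i , y₁ , releases-sole (here refl) c₁ λ
          { (here refl)                 _  → refl
          ; (there (here refl))         c₂ → contradiction c₂ ¬c₂
          ; (there (there (here refl))) c₃ → contradiction c₃ ¬c₃
          ; (there (there (there ())))  _
          })
  ... | yes c₂ | no ¬c₃ = let j , d₃ = cover (there (there (here refl))) in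
        inj₂ (j , y₃ , releases-other (there (there (here refl))) ¬c₃ d₃ λ
          { (here refl)                 → inj₂ c₁
          ; (there (here refl))         → inj₂ c₂
          ; (there (there (here refl))) → inj₁ refl
          ; (there (there (there ())))
          })
  ... | no ¬c₂ | yes c₃ = let j , d₂ = cover (there (here refl)) in
        inj₂ (j , y₂ , releases-other (there (here refl)) ¬c₂ d₂ λ
          { (here refl)                 → inj₂ c₁
          ; (there (here refl))         → inj₁ refl
          ; (there (there (here refl))) → inj₂ c₃
          ; (there (there (there ())))
          })
  guards-or-releases Cov? _ (_ ∷ _ ∷ _ ∷ _ ∷ _) (s≤s (s≤s (s≤s ()))) _

module _ (G : Graph) where
  open Graph G renaming (sym to adj-sym)
  open import Data.List.Membership.DecPropositional (_≟ᶠ_ {n}) using (_∈?_)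

  vertices : List (V G)
  vertices = allFin n

  -- An enumeration of a connected vertex set along a spanning tree: each vertex is new and
  -- adjacent to a later one.
  data TreeOrder : List (V G) → Set where
    [_]    : ∀ x → TreeOrder (x ∷ [])
    extend : ∀ {x p L} → TreeOrder L → x ∉ L → p ∈ L → Adj x p → TreeOrder (x ∷ L)

  TreeOrder⇒Unique : ∀ {L} → TreeOrder L → Unique L
  TreeOrder⇒Unique [ x ]              = All.[] ∷ []
  TreeOrder⇒Unique (extend t x∉L _ _) = ¬Any⇒All¬ _ x∉L ∷ TreeOrder⇒Unique t

  LowDegree : List (V G) → Set
  LowDegree L = (∀ {v} → v ∈ L → deg G v ≤ 3) ×
                (∀ {u v} → u ∈ L → v ∈ L → deg G u ≡ 3 → deg G v ≡ 3 → u ≡ v)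

  LowDegree-⊆ : ∀ {L′ L} → (∀ {v} → v ∈ L′ → v ∈ L) → LowDegree L → LowDegree L′
  LowDegree-⊆ sub (deg≤3 , one3) = deg≤3 ∘ sub , λ u∈ v∈ → one3 (sub u∈) (sub v∈)

  inDeg outDeg : List (V G) → V G → ℕ
  inDeg  L v = length (filter (adj? v ∩? (_∈? L)) vertices)
  outDeg L v = length (filter (adj? v ∩? ∁? (_∈? L)) vertices)

  -- A tree on |L| vertices has |L| - 1 edges, each counted twice.
  sum-inDeg-tree : ∀ {L} → TreeOrder L → length L + length L ≤ sum (map (inDeg L) L) + 2
  sum-inDeg-tree [ x ] = m≤n+m 2 _
  sum-inDeg-tree {x ∷ L} (extend {p = p} t x∉L p∈L x~p) = begin
    suc (length L) + suc (length L) ≡⟨ cong suc (+-suc (length L) (length L)) ⟩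
    2 + (length L + length L)       ≤⟨ +-monoʳ-≤ 2 (sum-inDeg-tree t) ⟩
    2 + (sum (map (inDeg L) L) + 2) ≤⟨ +-monoˡ-≤ 2 (+-mono-≤ x-has-neighbour sum-grows) ⟩
    sum (map (inDeg (x ∷ L)) (x ∷ L)) + 2 ∎
    where
    open ≤-Reasoning
    widen : ∀ {v u} → Adj v u × u ∈ L → Adj v u × u ∈ x ∷ L
    widen = Product.map₂ there
    x-has-neighbour : 1 ≤ inDeg (x ∷ L) x
    x-has-neighbour = filter-some (adj? x ∩? (_∈? (x ∷ L))) (lose (∈-allFin p) (x~p , there p∈L))
    sum-grows : sum (map (inDeg L) L) < sum (map (inDeg (x ∷ L)) L)
    sum-grows = sum-map-mono-< L (λ {v} _ → length-filter-mono (adj? v ∩? (_∈? L)) _ widen vertices) p∈L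
                  (length-filter-mono-< (adj? p ∩? (_∈? L)) _ widen (∈-allFin x) (adj-sym x~p , here refl) (x∉L ∘ proj₂))

  sum-outDeg≤3 : ∀ {L} → TreeOrder L → LowDegree L → sum (map (outDeg L) L) ≤ 3
  sum-outDeg≤3 {L} t (deg≤3 , one3) = +-cancelʳ-≤ (l + l) _ _ (begin
    Out + (l + l)           ≤⟨ +-monoʳ-≤ Out (sum-inDeg-tree t) ⟩
    Out + (In + 2)          ≡⟨ reorder Out In ⟩
    (In + Out) + 2          ≡⟨ cong (_+ 2) (sym degree-sum) ⟩
    sum (map (deg G) L) + 2 ≤⟨ +-monoˡ-≤ 2 (sum-map≤twice-length+1 (deg G) (TreeOrder⇒Unique t) deg≤3 one3) ⟩
    l + l + 1 + 2           ≡⟨ +-comm (l + l + 1) 2 ⟩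
    2 + (l + l + 1)         ≡⟨ cong (2 +_) (+-comm (l + l) 1) ⟩
    3 + (l + l)             ∎)
    where
    open ≤-Reasoning
    l   = length L
    In  = sum (map (inDeg L) L)
    Out = sum (map (outDeg L) L)
    degree-sum : sum (map (deg G) L) ≡ In + Out
    degree-sum = trans (cong sum (map-cong (λ v → length-filter-split (adj? v) (_∈? L) vertices) L))
                       (sum-map-+ (inDeg L) (outDeg L) L)
    reorder : ∀ a b → a + (b + 2) ≡ (b + a) + 2
    reorder = solve-∀

  Boundary : List (V G) → Pred (V G) 0ℓ
  Boundary L u = u ∉ L × Any (λ x → Adj x u) L

  boundary? : ∀ L → Decidable (Boundary L)
  boundary? L u = ¬? (u ∈? L) ×-dec Any.any? (λ x → adj? x u) L

  boundary : List (V G) → List (V G)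
  boundary L = filter (boundary? L) vertices

  ∈-boundary⁺ : ∀ {L u} → Boundary L u → u ∈ boundary L
  ∈-boundary⁺ {L} {u} = ∈-filter⁺ (boundary? L) (∈-allFin u)

  ∈-boundary⁻ : ∀ {L u} → u ∈ boundary L → Boundary L u
  ∈-boundary⁻ {L} = proj₂ ∘ ∈-filter⁻ (boundary? L) {xs = vertices}

  length-boundary≤3 : ∀ {L} → TreeOrder L → LowDegree L → length (boundary L) ≤ 3
  length-boundary≤3 {L} t low = begin
    length (boundary L)                                        ≤⟨ length-filter-mono (boundary? L) _ leaving vertices ⟩
    length (filter (λ u → Any.any? (λ x → R? x u) L) vertices) ≤⟨ length-filter-any≤sum R? L vertices ⟩
    sum (map (outDeg L) L)                                     ≤⟨ sum-outDeg≤3 t low ⟩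
    3                                                          ∎
    where
    open ≤-Reasoning
    R? : ∀ x u → Dec (Adj x u × u ∉ L)
    R? x = adj? x ∩? ∁? (_∈? L)
    leaving : ∀ {u} → Boundary L u → Any (λ x → Adj x u × u ∉ L) L
    leaving (u∉L , edge) = Any.map (_, u∉L) edge

  walk-leaves : ∀ {P a b} L → Walk G P a b → a ∈ L → b ∉ L → ∃ (Boundary L)
  walk-leaves L (nil _) a∈L a∉L = contradiction a∈L a∉L
  walk-leaves L (cons {w = w} _ a~w walk) a∈L b∉L with w ∈? L
  ... | yes w∈L = walk-leaves L walk w∈L b∉L
  ... | no w∉L  = w , w∉L , lose a∈L a~w

  walk-snoc : ∀ {P a b c} → Walk G P a b → Adj b c → P c → Walk G P a c
  walk-snoc (nil pa)         b~c pc = cons pa b~c (nil pc)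
  walk-snoc (cons pa e walk) b~c pc = cons pa e (walk-snoc walk b~c pc)

  walk-end : ∀ {P a b} → Walk G P a b → P b
  walk-end (nil pb)        = pb
  walk-end (cons _ _ walk) = walk-end walk

  record Component (U : Pred (V G) 0ℓ) (root : V G) : Set where
    field
      members   : List (V G)
      tree      : TreeOrder members
      root∈     : root ∈ members
      reachable : ∀ {v} → v ∈ members → Walk G U root v
      closed    : ∀ {x u} → x ∈ members → Adj x u → U u → u ∈ members

  unvisited : List (V G) → ℕ
  unvisited L = length (filter (∁? (_∈? L)) vertices)

  module _ {U : Pred (V G) 0ℓ} (U? : Decidable U) {root : V G} where

    grow : ∀ L → TreeOrder L → root ∈ L → (∀ {v} → v ∈ L → Walk G U root v) →
           Acc _<_ (unvisited L) → Component U root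
    grow L t root∈L reach (acc rec)
      with Fin.any? (λ u → (U? u ×-dec ¬? (u ∈? L)) ×-dec Any.any? (λ x → adj? x u) L)
    ... | no stuck = record { members = L ; tree = t ; root∈ = root∈L ; reachable = reach ; closed = closed }
      where
      closed : ∀ {x u} → x ∈ L → Adj x u → U u → u ∈ L
      closed {u = u} x∈L x~u uu with u ∈? L
      ... | yes u∈L = u∈L
      ... | no u∉L  = contradiction (u , (uu , u∉L) , lose x∈L x~u) stuck
    ... | yes (u , (uu , u∉L) , edge) with find edge
    ...   | x , x∈L , x~u = grow (u ∷ L) (extend t u∉L x∈L (adj-sym x~u)) (there root∈L) reach′ (rec fewer)
      where
      reach′ : ∀ {v} → v ∈ u ∷ L → Walk G U root v
      reach′ (here refl) = walk-snoc (reach x∈L) x~u uu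
      reach′ (there v∈L) = reach v∈L
      fewer : unvisited (u ∷ L) < unvisited L
      fewer = length-filter-mono-< (∁? (_∈? (u ∷ L))) (∁? (_∈? L)) (λ ∉uL ∈L → ∉uL (there ∈L))
                (∈-allFin u) u∉L (λ u∉uL → u∉uL (here refl))

    component : U root → Component U root
    component u-root = grow (root ∷ []) [ root ] (here refl) (λ { (here refl) → nil u-root })
                         (<-wellFounded _)

module Pursuit (G : Graph) (conn : Connected G) (m : ℕ) where
  open Graph G renaming (sym to adj-sym)
  open import Data.List.Membership.DecPropositional (_≟ᶠ_ {n}) using (_∈?_)

  Cop : Set
  Cop = Fin (2 + m)

  Cops : Set
  Cops = Cop → V G

  another : Cop → Cop
  another zero    = suc zero
  another (suc _) = zero

  another≢ : ∀ i → another i ≢ i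
  another≢ zero    ()
  another≢ (suc _) ()

  closedNbhd? : ∀ v u → Dec (InClosedNbhd G v u)
  closedNbhd? v u = (u ≟ᶠ v) ⊎-dec adj? v u

  guarded? : ∀ (C : Cops) → Decidable (InNC G C)
  guarded? C u = Fin.any? (λ i → closedNbhd? (C i) u)

  _[_≔_] : Cops → Cop → V G → Cops
  C [ i ≔ y ] = updateAt C i (const y)

  moved : ∀ C i {y} → (C [ i ≔ y ]) i ≡ y
  moved C i = updateAt-updates i C

  unmoved : ∀ C {i y} j → j ≢ i → (C [ i ≔ y ]) j ≡ C j
  unmoved C j j≢i = updateAt-minimal j _ C j≢i

  still-covers : ∀ C {i y u} j → j ≢ i → InClosedNbhd G (C j) u → InClosedNbhd G ((C [ i ≔ y ]) j) u
  still-covers C j j≢i = subst (λ c → InClosedNbhd G c _) (sym (unmoved C j j≢i))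

  move-one : ∀ C i {y} → InClosedNbhd G (C i) y → CopMove G C (C [ i ≔ y ])
  move-one C i i→y j with j ≟ᶠ i
  ... | yes refl = subst (InClosedNbhd G (C i)) (sym (moved C i)) i→y
  ... | no j≢i   = inj₁ (unmoved C j j≢i)

  capture : ∀ {C r} → InNC G C r → CopsWin G C r
  capture {C} {r} (i , i→r) = win (C [ i ≔ r ]) (move-one C i i→r) (inj₁ (i , moved C i))

  Sealed : Cops → List (V G) → Set
  Sealed C L = Boundary G L ⊆ InNC G C

  record Trap (C : Cops) (r : V G) : Set where
    field
      region    : List (V G)
      tree      : TreeOrder G region
      low       : LowDegree G region
      robber∈   : r ∈ region
      unguarded : ∀ {v} → v ∈ region → ¬ InNC G C v
      sealed    : Sealed C region

  open Trap

  size : List (V G) → ℕ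
  size L = length (filter (_∈? L) (vertices G))

  SmallerTrapsWin : List (V G) → Set
  SmallerTrapsWin L = ∀ {C r} (t : Trap C r) → size (region t) < size L → CopsWin G C r

  respond : ∀ {C r C′} (t : Trap C r) → CopMove G C C′ → Sealed C′ (region t) →
            (∀ {r′} → r′ ∈ region t → ¬ InNC G C′ r′ → CopsWin G C′ r′) → CopsWin G C r
  respond {C} {r} {C′} t mv sealed′ stay = win C′ mv (inj₂ reply)
    where
    reply : ∀ r′ → InClosedNbhd G r r′ → Captured G C′ r′ ⊎ CopsWin G C′ r′
    reply r′ r→r′ with guarded? C′ r′ | r′ ∈? region t
    ... | yes caught | _       = inj₂ (capture caught)
    ... | no free    | yes r′∈ = inj₂ (stay r′∈ free)
    ... | no free    | no r′∉  = contradiction (sealed′ (r′∉ , exit r→r′)) free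
      where
      exit : InClosedNbhd G r r′ → Any (λ x → Adj x r′) (region t)
      exit (inj₁ refl) = contradiction (robber∈ t) r′∉
      exit (inj₂ r~r′) = lose (robber∈ t) r~r′

  retrap : ∀ {C r C′ r′} (t : Trap C r) → Sealed C′ (region t) → r′ ∈ region t → ¬ InNC G C′ r′ →
           Σ (Trap C′ r′) λ t′ → ∀ {v} → v ∈ region t′ → v ∈ region t × ¬ InNC G C′ v
  retrap {C′ = C′} t sealed′ r′∈ r′-free = trap′ , inside
    where
    comp : Component G (λ v → v ∈ region t × ¬ InNC G C′ v) _
    comp = component G ((_∈? region t) ∩? ∁? (guarded? C′)) (r′∈ , r′-free)
    open Component comp using (members; reachable; closed; root∈)
    inside : ∀ {v} → v ∈ members → v ∈ region t × ¬ InNC G C′ v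
    inside = walk-end G ∘ reachable
    sealed″ : Sealed C′ members
    sealed″ {u} (u∉ , edge) with find edge | guarded? C′ u | u ∈? region t
    ... | _ , _ , _     | yes caught | _       = caught
    ... | _ , x∈ , x~u  | no free    | yes u∈  = contradiction (closed x∈ x~u (u∈ , free)) u∉
    ... | _ , x∈ , x~u  | no _       | no u∉′  = sealed′ (u∉′ , lose (proj₁ (inside x∈)) x~u)
    trap′ : Trap C′ _
    trap′ = record
      { region = members ; tree = Component.tree comp ; low = LowDegree-⊆ G (proj₁ ∘ inside) (low t)
      ; robber∈ = root∈ ; unguarded = proj₂ ∘ inside ; sealed = sealed″ }

  advance : ∀ {C r C′ s} (t : Trap C r) → SmallerTrapsWin (region t) → CopMove G C C′ →
            Sealed C′ (region t) → s ∈ region t → InNC G C′ s → CopsWin G C r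
  advance {s = s} t ih mv sealed′ s∈ s-caught = respond t mv sealed′ λ r′∈ r′-free →
    let t′ , inside = retrap t sealed′ r′∈ r′-free
    in ih t′ (length-filter-mono-< (_∈? region t′) (_∈? region t) (proj₁ ∘ inside) (∈-allFin s) s∈
                (λ s∈′ → proj₂ (inside s∈′) s-caught))

  relocate : ∀ {C r C′ r′} (t : Trap C r) → Sealed C′ (region t) →
             (∀ {v} → v ∈ region t → ¬ InNC G C′ v) → r′ ∈ region t → Trap C′ r′
  relocate t sealed′ unguarded′ r′∈ = record
    { region = region t ; tree = tree t ; low = low t ; robber∈ = r′∈ ; unguarded = unguarded′ ; sealed = sealed′ }

  -- Cop i keeps the region sealed on its own while cop j walks towards it.
  approach : ∀ {C r} (t : Trap C r) → SmallerTrapsWin (region t) → ∀ i j → j ≢ i →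
             Boundary G (region t) ⊆ InClosedNbhd G (C i) →
             ∀ {x y c} → x ∈ region t → Adj x y → Walk G (λ _ → ⊤) c y → C j ≡ c → CopsWin G C r
  approach t ih i j j≢i guard x∈ x~y (nil _) refl = contradiction (j , inj₂ (adj-sym x~y)) (unguarded t x∈)
  approach {C} {r} t ih i j j≢i guard x∈ x~y (cons {w = w} _ c~w walk) refl =
    step (Any.any? (guarded? C′) (region t))
    where
    C′ = C [ j ≔ w ]
    mv : CopMove G C C′
    mv = move-one C j (inj₂ c~w)
    guard′ : Boundary G (region t) ⊆ InClosedNbhd G (C′ i)
    guard′ = still-covers C i (j≢i ∘ sym) ∘ guard
    sealed′ : Sealed C′ (region t)
    sealed′ b = i , guard′ b
    step : Dec (Any (InNC G C′) (region t)) → CopsWin G C r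
    step (yes caught)   = let _ , s∈ , s-caught = find caught in advance t ih mv sealed′ s∈ s-caught
    step (no untouched) = respond t mv sealed′ λ r′∈ _ →
      approach (relocate t sealed′ (λ v∈ caught → untouched (lose v∈ caught)) r′∈)
               ih i j j≢i guard′ x∈ x~y walk (moved C j)

  Covers : Cops → Cop → V G → Set
  Covers C i = InClosedNbhd G (C i)

  chase : ∀ {C r} (t : Trap C r) → SmallerTrapsWin (region t) → ∀ i →
          Guards (Covers C) i (boundary G (region t)) → CopsWin G C r
  chase {C} {r} t ih i guard =
    approach t ih i (another i) (another≢ i) (guard ∘ ∈-boundary⁺ G) x∈ x~y (conn _ y) refl
    where
    cop-outside : C i ∉ region t
    cop-outside ci∈ = unguarded t ci∈ (i , inj₁ refl)
    exit : ∃ (Boundary G (region t))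
    exit = walk-leaves G (region t) (conn r (C i)) (robber∈ t) cop-outside
    y = proj₁ exit
    edge = find (proj₂ (proj₂ exit))
    x∈ = proj₁ (proj₂ edge)
    x~y = proj₂ (proj₂ edge)

  release : ∀ {C r} (t : Trap C r) → SmallerTrapsWin (region t) → ∀ {a y} →
            Releases (Covers C) a y (boundary G (region t)) → CopsWin G C r
  release {C} t ih {a} {y} (y∈ , a→y , others) =
    advance t ih (move-one C a a→y) sealed′ s∈ s-caught
    where
    C′ = C [ a ≔ y ]
    edge = find (proj₂ (∈-boundary⁻ G y∈))
    s∈ = proj₁ (proj₂ edge)
    s~y = proj₂ (proj₂ edge)
    s-caught : InNC G C′ (proj₁ edge)
    s-caught = a , inj₂ (subst (λ c → Adj c _) (sym (moved C a)) (adj-sym s~y))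
    sealed′ : Sealed C′ (region t)
    sealed′ {u} u-out with sealed t u-out
    ... | i , i→u with i ≟ᶠ a
    ...   | no i≢a = i , still-covers C i i≢a i→u
    ...   | yes refl with others (∈-boundary⁺ G u-out) i→u
    ...     | inj₁ refl            = a , inj₁ (sym (moved C a))
    ...     | inj₂ (j , j≢a , j→u) = j , still-covers C j j≢a j→u

  cornered : ∀ {C r} (t : Trap C r) → SmallerTrapsWin (region t) → CopsWin G C r
  cornered {C} t ih with guards-or-releases (Covers C) (λ i → closedNbhd? (C i)) zero (boundary G (region t))
                           (length-boundary≤3 G (tree t) (low t)) (sealed t ∘ ∈-boundary⁻ G)
  ... | inj₁ (i , guard)       = chase t ih i guard
  ... | inj₂ (_ , _ , release′) = release t ih release′

  trap-wins : ∀ {C r} (t : Trap C r) → Acc _<_ (size (region t)) → CopsWin G C r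
  trap-wins t (acc rec) = cornered t (λ t′ smaller → trap-wins t′ (rec smaller))

  cops-win : ∀ {C r} → (∀ v → InSafe G C r v → deg G v ≤ 3) →
             (∀ u v → InSafe G C r u → InSafe G C r v → deg G u ≡ 3 → deg G v ≡ 3 → u ≡ v) →
             CopsWin G C r
  cops-win {C} {r} deg≤3 one3 with guarded? C r
  ... | yes caught = capture caught
  ... | no free    = trap-wins safe-trap (<-wellFounded _)
    where
    comp : Component G (λ u → ¬ InNC G C u) r
    comp = component G (∁? (guarded? C)) free
    open Component comp using (members; reachable; closed; root∈)
    sealed″ : Sealed C members
    sealed″ {u} (u∉ , edge) with guarded? C u | find edge
    ... | yes caught | _             = caught
    ... | no u-free  | _ , x∈ , x~u  = contradiction (closed x∈ x~u u-free) u∉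
    safe-trap : Trap C r
    safe-trap = record
      { region = members ; tree = Component.tree comp
      ; low = (λ v∈ → deg≤3 _ (reachable v∈)) , (λ u∈ v∈ → one3 _ _ (reachable u∈) (reachable v∈))
      ; robber∈ = root∈ ; unguarded = walk-end G ∘ reachable ; sealed = sealed″ }

corollary7 : (G : Graph) → Connected G →
    (k : ℕ) → k ≥ 2 → (C : Fin k → V G) → (r : V G) →
    (∀ v → InSafe G C r v → deg G v ≤ 3) →
    (∀ u v → InSafe G C r u → InSafe G C r v → deg G u ≡ 3 → deg G v ≡ 3 → u ≡ v) →
    CopsWin G C r
corollary7 G conn (suc (suc m)) (s≤s (s≤s z≤n)) C r = Pursuit.cops-win G conn m
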